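{- Let $h\colon[n]\to[n]$ be a Hessenberg function and $w\in\mathfrak S_n$ a well-organized generator for $h$. (1) If $h(w^{ -1}(1))<n$ and $w$ avoids the associated pattern $[2134]_h$, then $w$ is a well-organized generator of the first kind. If in addition $w$ avoids $[1243]_h$ and $[1423]_h$, then $w(i)\in Y(w)$ for all $i$ with $h(i)=n$. (2) If $h(w^{ -1}(1))=n$ and $w$ avoids the associated patterns $[2143]_h$ and $[2134]_h$, then $w$ is a well-organized generator of the first or the second kind.
   Context: A Hessenberg function is a nondecreasing $h\colon[n]\to[n]$ with $h(i)\ge i$. Permutations are in one-line notation. A generator for $h$ is a $w$ with $w^{ -1}(w(i)+1)\le h(i)$ whenever $w(i)\le n-1$. $Y(w)=\{w(i)\mid i\ge w^{ -1}(1),\ w(i)\le w(n)\}=\{y_0<\cdots<y_r\}$; $w$ is well-organized if $w^{ -1}(y_0)<\cdots<w^{ -1}(y_r)=n$; a well-organized $w$ is of the first kind if $y_i=i+1$ for $0\le i\le r$, and of the second kind if $w(n-i)=y_{r-i}$ for $0\le i\le r$. Associated patterns: $w$ contains $[2143]_h$ if $w(j)<w(i)<w(\ell)<w(k)$ for some $i<j<k<\ell\le h(i)$; $[1243]_h$ if $w(i)<w(j)<w(\ell)<w(k)$ for some $i<j<k<\ell\le h(j)$ with $j\le h(i)<\ell$; $[2134]_h$ if $w(j)<w(i)<w(k)<w(\ell)$ for some $i<j<k<\ell\le h(k)$ with $k\le h(i)<\ell$; $[1423]_h$ if $w(i)<w(k)<w(\ell)<w(j)$ for some $i<j<k<\ell\le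 h(j)$ with $k\le h(i)<\ell$. -}

module Defs where

open import Data.Nat using (ℕ; zero; suc; _+_; _∸_; _≤_; _<_; _≤?_; _≟_)
open import Data.Fin using (Fin; toℕ; opposite) renaming (_<_ to _<ᶠ_)
open import Data.List using (List; []; _∷_; map; upTo; filter; length; lookup)
open import Data.List.Membership.Propositional using (_∈_)
open import Data.Product using (Σ; _×_; _,_)
open import Relation.Nullary using (¬_; yes; no)
open import Relation.Nullary.Decidable using (_×-dec_)
open import Relation.Binary.PropositionalEquality using (_≡_)

-- Convention: [n] = {1,…,n}; functions [n] → [n] are modelled as ℕ → ℕ,
-- and only their values on 1..n ever matter.

range : ℕ → List ℕ
range n = map suc (upTo n)

IsHessenberg : ℕ → (ℕ → ℕ) → Set
IsHessenberg n h =
  (∀ i → 1 ≤ i → i ≤ n → i ≤ h i × h i ≤ n) ×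
  (∀ i j → 1 ≤ i → i ≤ j → j ≤ n → h i ≤ h j)

IsPerm : ℕ → (ℕ → ℕ) → Set
IsPerm n w =
  (∀ i → 1 ≤ i → i ≤ n → 1 ≤ w i × w i ≤ n) ×
  (∀ i j → 1 ≤ i → i ≤ n → 1 ≤ j → j ≤ n → w i ≡ w j → i ≡ j) ×
  (∀ v → 1 ≤ v → v ≤ n → Σ ℕ λ i → 1 ≤ i × i ≤ n × w i ≡ v)

-- inverse permutation: w⁻¹(v) = the (first) i ∈ [n] with w(i) = v
-- (returns 0 if there is none; never happens for a permutation and v ∈ [n])
invFrom : (ℕ → ℕ) → ℕ → List ℕ → ℕ
invFrom w v [] = 0
invFrom w v (i ∷ is) with w i ≟ v
... | yes _ = i
... | no  _ = invFrom w v is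

inv : ℕ → (ℕ → ℕ) → ℕ → ℕ
inv n w v = invFrom w v (range n)

IsGenerator : ℕ → (ℕ → ℕ) → (ℕ → ℕ) → Set
IsGenerator n h w = ∀ i → 1 ≤ i → i ≤ n → w i ≤ n ∸ 1 → inv n w (w i + 1) ≤ h i

-- Y(w) = {w(i) | i ≥ w⁻¹(1), w(i) ≤ w(n)}, listed increasingly as y₀ < … < y_r
-- (written as {v ∈ [n] | w⁻¹(v) ≥ w⁻¹(1), v ≤ w(n)}, filtered from 1..n)
Y : ℕ → (ℕ → ℕ) → List ℕ
Y n w = filter (λ v → (inv n w 1 ≤? inv n w v) ×-dec (v ≤? w n)) (range n)

y : (n : ℕ) (w : ℕ → ℕ) → Fin (length (Y n w)) → ℕ
y n w k = lookup (Y n w) k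

IsWellOrganized : ℕ → (ℕ → ℕ) → Set
IsWellOrganized n w =
  (∀ a b → a <ᶠ b → inv n w (y n w a) < inv n w (y n w b)) ×
  (∀ a → suc (toℕ a) ≡ length (Y n w) → inv n w (y n w a) ≡ n)

FirstKind : ℕ → (ℕ → ℕ) → Set
FirstKind n w = IsWellOrganized n w × (∀ a → y n w a ≡ toℕ a + 1)

-- second kind: w(n - i) = y_{r - i} for 0 ≤ i ≤ r
-- (toℕ (opposite i) = r - toℕ i, where r + 1 = |Y(w)|)
SecondKind : ℕ → (ℕ → ℕ) → Set
SecondKind n w = IsWellOrganized n w × (∀ i → w (n ∸ toℕ i) ≡ y n w (opposite i))

Contains2143 : ℕ → (ℕ → ℕ) → (ℕ → ℕ) → Set
Contains2143 n h w = Σ ℕ λ i → Σ ℕ λ j → Σ ℕ λ k → Σ ℕ λ l →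
  1 ≤ i × i < j × j < k × k < l × l ≤ n × l ≤ h i ×
  w j < w i × w i < w l × w l < w k

Contains1243 : ℕ → (ℕ → ℕ) → (ℕ → ℕ) → Set
Contains1243 n h w = Σ ℕ λ i → Σ ℕ λ j → Σ ℕ λ k → Σ ℕ λ l →
  1 ≤ i × i < j × j < k × k < l × l ≤ n × l ≤ h j × j ≤ h i × h i < l ×
  w i < w j × w j < w l × w l < w k

Contains2134 : ℕ → (ℕ → ℕ) → (ℕ → ℕ) → Set
Contains2134 n h w = Σ ℕ λ i → Σ ℕ λ j → Σ ℕ λ k → Σ ℕ λ l →
  1 ≤ i × i < j × j < k × k < l × l ≤ n × l ≤ h k × k ≤ h i × h i < l ×
  w j < w i × w i < w k × w k < w l

Contains1423 : ℕ → (ℕ → ℕ) → (ℕ → ℕ) → Set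
Contains1423 n h w = Σ ℕ λ i → Σ ℕ λ j → Σ ℕ λ k → Σ ℕ λ l →
  1 ≤ i × i < j × j < k × k < l × l ≤ n × l ≤ h j × k ≤ h i × h i < l ×
  w i < w k × w k < w l × w l < w j

module Submission where

-- Write m = w(n) and o = w⁻¹(1); the generator condition reads w⁻¹(v+1) ≤ h(w⁻¹ v), and
-- Y = {v ≤ m | w⁻¹ v ≥ o}. Call v < m a straggler if it stands left of the 1; without
-- stragglers Y = {1,…,m}, the first kind. For the last straggler v with h(w⁻¹ v) < n, follow
-- v+1, v+2, …: since m sits at position n, some t, t+1 jump from within h(w⁻¹ v) to beyond it,
-- and (w⁻¹ v, o, w⁻¹ t, w⁻¹(t+1)) is a [2134]_h. In (1), h(o) < n forces h(w⁻¹ v) < n for every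
-- straggler, so there are none. In (2), a last straggler with h(w⁻¹ v) = n makes every value right
-- of the 1 at most m (else v, 1, it and m form a [2143]_h), so Y fills the positions o,…,n in
-- increasing order: the second kind. For the last claim of (1), a value x > m with h(w⁻¹ x) = n
-- lies strictly between the positions of some a and a+1 ≤ m; the last d ≤ a with h(w⁻¹ d) < n
-- then yields a [1243]_h directly, or, following d+1, d+2, … to the jump beyond h(w⁻¹ d), a
-- [1243]_h or [1423]_h according to the side of w⁻¹ x on which the jump starts.


open import Defs
open import Data.Empty using (⊥; ⊥-elim)
open import Data.Fin as Fin using (Fin; toℕ; opposite; fromℕ<)
import Data.Fin.Properties as Fin
open import Data.List using ([]; _∷_; _++_; applyUpTo; filter; length; lookup)
open import Data.List.Properties
  using (map-upTo; applyUpTo-∷ʳ; filter-++; filter-accept; filter-reject; ++-identityʳ; lookup-applyUpTo)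
open import Data.List.Membership.Propositional using (_∈_)
open import Data.List.Membership.Propositional.Properties
  using (∈-map⁺; ∈-map⁻; ∈-upTo⁺; ∈-upTo⁻; ∈-filter⁺; ∈-filter⁻; ∈-lookup)
open import Data.List.Relation.Unary.Any using (here; there; index)
open import Data.List.Relation.Unary.Any.Properties using (lookup-index)
import Data.List.Relation.Unary.All as All
open import Data.List.Relation.Unary.AllPairs using (AllPairs; _∷_)
import Data.List.Relation.Unary.AllPairs.Properties as AllPairs
open import Data.Nat
open import Data.Nat.Properties
open import Data.Product using (∃-syntax; _×_; _,_; proj₁; proj₂; uncurry)
open import Data.Sum as Sum using (_⊎_; inj₁; inj₂; [_,_])
open import Function using (_∘_; _⇔_; mk⇔; Equivalence)
open import Relation.Nullary using (¬_; Dec; yes; no)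
open import Relation.Nullary.Decidable using (_×-dec_)
open import Relation.Unary using (Pred; Decidable)
open import Relation.Binary.Definitions using (Tri; tri<; tri≈; tri>)
open import Relation.Binary.PropositionalEquality hiding ([_])

module _ {q} {Q : Pred ℕ q} (Q? : Decidable Q) where

  crossing : ∀ {a b} → a ≤ b → Q a → ¬ Q b → ∃[ t ] a ≤ t × t < b × Q t × ¬ Q (suc t)
  crossing {b = zero}  z≤n Qa ¬Qb = ⊥-elim (¬Qb Qa)
  crossing {b = suc b} a≤b Qa ¬Qb with m≤n⇒m<n∨m≡n a≤b
  ... | inj₂ refl = ⊥-elim (¬Qb Qa)
  ... | inj₁ a≤b′ with Q? b
  ...   | yes Qb = b , ≤-pred a≤b′ , ≤-refl , Qb , ¬Qb
  ...   | no ¬Qb′ with crossing (≤-pred a≤b′) Qa ¬Qb′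
  ...     | t , a≤t , t<b , Qt , ¬Qt+1 = t , a≤t , m≤n⇒m≤1+n t<b , Qt , ¬Qt+1

  greatest-below : ∀ d → (∀ v → v < d → ¬ Q v) ⊎ (∃[ v ] v < d × Q v × (∀ u → v < u → u < d → ¬ Q u))
  greatest-below zero = inj₁ λ _ ()
  greatest-below (suc d) with Q? d | greatest-below d
  ... | yes Qd | _ = inj₂ (d , ≤-refl , Qd , λ u d<u u<d+1 → ⊥-elim (<⇒≱ d<u (≤-pred u<d+1)))
  ... | no ¬Qd | inj₁ none = inj₁ λ v v<d+1 → [ none v , (λ { refl → ¬Qd }) ] (m<1+n⇒m<n∨m≡n v<d+1)
  ... | no ¬Qd | inj₂ (v , v<d , Qv , above) =
    inj₂ (v , m≤n⇒m≤1+n v<d , Qv ,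
          λ u v<u u<d+1 → [ above u v<u , (λ { refl → ¬Qd }) ] (m<1+n⇒m<n∨m≡n u<d+1))

invFrom-∈ : ∀ (w : ℕ → ℕ) v {i is} → i ∈ is → w i ≡ v → invFrom w v is ∈ is × w (invFrom w v is) ≡ v
invFrom-∈ w v {is = j ∷ is} i∈ wi≡v with w j ≟ v | i∈
... | yes wj≡v | _       = here refl , wj≡v
... | no wj≢v  | here refl = ⊥-elim (wj≢v wi≡v)
... | no _     | there i∈′ with invFrom-∈ w v i∈′ wi≡v
...   | r∈ , wr≡v = there r∈ , wr≡v

∈-range⁻ : ∀ {n v} → v ∈ range n → 1 ≤ v × v ≤ n
∈-range⁻ v∈ with ∈-map⁻ suc v∈
... | _ , u∈ , refl = s≤s z≤n , ∈-upTo⁻ u∈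

∈-range⁺ : ∀ {n v} → 1 ≤ v → v ≤ n → v ∈ range n
∈-range⁺ {v = suc u} _ u<n = ∈-map⁺ suc (∈-upTo⁺ u<n)

range-sorted : ∀ n → AllPairs _<_ (range n)
range-sorted n = subst (AllPairs _<_) (sym (map-upTo suc n)) (AllPairs.applyUpTo⁺₁ suc n (λ i<j _ → s≤s i<j))

AllPairs-lookup : ∀ {R : ℕ → ℕ → Set} {xs} → AllPairs R xs →
                  ∀ {a b : Fin (length xs)} → a Fin.< b → R (lookup xs a) (lookup xs b)
AllPairs-lookup (Rx ∷ _)   {Fin.zero}  {Fin.suc b} _         = All.lookup Rx (∈-lookup b)
AllPairs-lookup (_ ∷ Rxs)  {Fin.suc a} {Fin.suc b} (s≤s a<b) = AllPairs-lookup Rxs a<b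

filter-applyUpTo-suc : ∀ {p} {P : Pred ℕ p} (P? : Decidable P) m k →
                       (∀ {v} → 1 ≤ v → v ≤ k → P v ⇔ v ≤ m) →
                       filter P? (applyUpTo suc k) ≡ applyUpTo suc (m ⊓ k)
filter-applyUpTo-suc P? m zero    _  = cong (applyUpTo suc) (sym (⊓-zeroʳ m))
filter-applyUpTo-suc {P = P} P? m (suc k) P⇔ = begin
  filter P? (applyUpTo suc (suc k))                          ≡⟨ cong (filter P?) (applyUpTo-∷ʳ suc k) ⟨
  filter P? (applyUpTo suc k ++ suc k ∷ [])                  ≡⟨ filter-++ P? (applyUpTo suc k) _ ⟩
  filter P? (applyUpTo suc k) ++ filter P? (suc k ∷ [])      ≡⟨ cong (_++ _) (filter-applyUpTo-suc P? m k P⇔′) ⟩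
  applyUpTo suc (m ⊓ k) ++ filter P? (suc k ∷ [])            ≡⟨ append-last (suc k ≤? m) ⟩
  applyUpTo suc (m ⊓ suc k)                                  ∎
  where
  open ≡-Reasoning
  P⇔′ : ∀ {v} → 1 ≤ v → v ≤ k → P v ⇔ v ≤ m
  P⇔′ 1≤v v≤k = P⇔ 1≤v (m≤n⇒m≤1+n v≤k)
  P⇔k+1 : P (suc k) ⇔ suc k ≤ m
  P⇔k+1 = P⇔ (s≤s z≤n) ≤-refl
  append-last : Dec (suc k ≤ m) → applyUpTo suc (m ⊓ k) ++ filter P? (suc k ∷ []) ≡ applyUpTo suc (m ⊓ suc k)
  append-last (yes k<m) = begin
    applyUpTo suc (m ⊓ k) ++ filter P? (suc k ∷ [])  ≡⟨ cong₂ (λ j xs → applyUpTo suc j ++ xs)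
                                                          (m≥n⇒m⊓n≡n (<⇒≤ k<m))
                                                          (filter-accept P? (Equivalence.from P⇔k+1 k<m)) ⟩
    applyUpTo suc k ++ suc k ∷ []                    ≡⟨ applyUpTo-∷ʳ suc k ⟩
    applyUpTo suc (suc k)                            ≡⟨ cong (applyUpTo suc) (m≥n⇒m⊓n≡n k<m) ⟨
    applyUpTo suc (m ⊓ suc k)                        ∎
  append-last (no k≮m) = begin
    applyUpTo suc (m ⊓ k) ++ filter P? (suc k ∷ [])  ≡⟨ cong (applyUpTo suc (m ⊓ k) ++_)
                                                          (filter-reject P? (k≮m ∘ Equivalence.to P⇔k+1)) ⟩
    applyUpTo suc (m ⊓ k) ++ []                      ≡⟨ ++-identityʳ _ ⟩
    applyUpTo suc (m ⊓ k)                            ≡⟨ cong (applyUpTo suc) (trans (m≤n⇒m⊓n≡m m≤k)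
                                                                                    (sym (m≤n⇒m⊓n≡m (m≤n⇒m≤1+n m≤k)))) ⟩
    applyUpTo suc (m ⊓ suc k)                        ∎
    where m≤k = ≤-pred (≰⇒> k≮m)

lookup-applyUpTo-suc : ∀ {xs} k → xs ≡ applyUpTo suc k → ∀ a → lookup xs a ≡ toℕ a + 1
lookup-applyUpTo-suc k refl a = trans (lookup-applyUpTo suc k a) (+-comm 1 (toℕ a))

pred-bounds : ∀ {a k} → a < k → a ≤ pred k × pred k < k
pred-bounds (s≤s a≤pred-k) = a≤pred-k , ≤-refl

module StrictlyMonotone {k} {f : Fin k → ℕ} (f-strictMono : ∀ {a b} → a Fin.< b → f a < f b) where

  mono : ∀ {a b} → a Fin.≤ b → f a ≤ f b
  mono {a} {b} a≤b with m≤n⇒m<n∨m≡n a≤b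
  ... | inj₁ a<b = <⇒≤ (f-strictMono a<b)
  ... | inj₂ a≡b rewrite Fin.toℕ-injective a≡b = ≤-refl

  reflects-< : ∀ {a b} → f a < f b → a Fin.< b
  reflects-< fa<fb = ≰⇒> λ b≤a → <⇒≱ fa<fb (mono b≤a)

  reflects-≤ : ∀ {a b} → f a ≤ f b → a Fin.≤ b
  reflects-≤ fa≤fb = ≮⇒≥ λ b<a → <⇒≱ (f-strictMono b<a) fa≤fb

module Positions {n : ℕ} {w : ℕ → ℕ} (perm : IsPerm n w) where

  w⁻¹ : ℕ → ℕ
  w⁻¹ = inv n w

  w-bounded : ∀ {i} → 1 ≤ i → i ≤ n → 1 ≤ w i × w i ≤ n
  w-bounded = proj₁ perm _

  w⁻¹-spec : ∀ {v} → 1 ≤ v → v ≤ n → (1 ≤ w⁻¹ v × w⁻¹ v ≤ n) × w (w⁻¹ v) ≡ v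
  w⁻¹-spec 1≤v v≤n with _ , 1≤i , i≤n , wi≡v ← proj₂ (proj₂ perm) _ 1≤v v≤n
    with r∈ , wr≡v ← invFrom-∈ w _ (∈-range⁺ 1≤i i≤n) wi≡v = ∈-range⁻ r∈ , wr≡v

  w⁻¹-bounded : ∀ {v} → 1 ≤ v → v ≤ n → 1 ≤ w⁻¹ v × w⁻¹ v ≤ n
  w⁻¹-bounded 1≤v v≤n = proj₁ (w⁻¹-spec 1≤v v≤n)

  w∘w⁻¹ : ∀ {v} → 1 ≤ v → v ≤ n → w (w⁻¹ v) ≡ v
  w∘w⁻¹ 1≤v v≤n = proj₂ (w⁻¹-spec 1≤v v≤n)

  w⁻¹∘w : ∀ {i} → 1 ≤ i → i ≤ n → w⁻¹ (w i) ≡ i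
  w⁻¹∘w 1≤i i≤n with 1≤wi , wi≤n ← w-bounded 1≤i i≤n with 1≤j , j≤n ← w⁻¹-bounded 1≤wi wi≤n =
    proj₁ (proj₂ perm) _ _ 1≤j j≤n 1≤i i≤n (w∘w⁻¹ 1≤wi wi≤n)

  w⁻¹-injective : ∀ {u v} → 1 ≤ u → u ≤ n → 1 ≤ v → v ≤ n → w⁻¹ u ≡ w⁻¹ v → u ≡ v
  w⁻¹-injective 1≤u u≤n 1≤v v≤n eq = trans (sym (w∘w⁻¹ 1≤u u≤n)) (trans (cong w eq) (w∘w⁻¹ 1≤v v≤n))

  w∘w⁻¹-< : ∀ {u v} → 1 ≤ u → u < v → v ≤ n → w (w⁻¹ u) < w (w⁻¹ v)
  w∘w⁻¹-< 1≤u u<v v≤n =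
    subst₂ _<_ (sym (w∘w⁻¹ 1≤u (<⇒≤ (<-≤-trans u<v v≤n)))) (sym (w∘w⁻¹ (≤-trans 1≤u (<⇒≤ u<v)) v≤n)) u<v

module Setting {n : ℕ} {h w : ℕ → ℕ} (hess : IsHessenberg n h) (perm : IsPerm n w)
               (gen : IsGenerator n h w) (wo : IsWellOrganized n w) (1≤n : 1 ≤ n) where

  open Positions perm

  h-bounded : ∀ {i} → 1 ≤ i → i ≤ n → i ≤ h i × h i ≤ n
  h-bounded = proj₁ hess _

  h-mono : ∀ {i j} → 1 ≤ i → i ≤ j → j ≤ n → h i ≤ h j
  h-mono = proj₂ hess _ _

  generator : ∀ {v} → 1 ≤ v → v < n → w⁻¹ (suc v) ≤ h (w⁻¹ v)
  generator {v} 1≤v v<n =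
    subst (λ u → w⁻¹ u ≤ h (w⁻¹ v)) (trans (cong (_+ 1) (w∘w⁻¹ 1≤v v≤n)) (+-comm v 1))
      (gen _ 1≤j j≤n (subst (_≤ n ∸ 1) (sym (w∘w⁻¹ 1≤v v≤n)) (∸-monoˡ-≤ 1 v<n)))
    where
    v≤n = <⇒≤ v<n
    1≤j = proj₁ (w⁻¹-bounded 1≤v v≤n)
    j≤n = proj₂ (w⁻¹-bounded 1≤v v≤n)

  m : ℕ
  m = w n

  1≤m : 1 ≤ m
  1≤m = proj₁ (w-bounded 1≤n ≤-refl)

  m≤n : m ≤ n
  m≤n = proj₂ (w-bounded 1≤n ≤-refl)

  w⁻¹m≡n : w⁻¹ m ≡ n
  w⁻¹m≡n = w⁻¹∘w 1≤n ≤-refl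

  o : ℕ
  o = w⁻¹ 1

  1≤o : 1 ≤ o
  1≤o = proj₁ (w⁻¹-bounded ≤-refl 1≤n)

  o≤n : o ≤ n
  o≤n = proj₂ (w⁻¹-bounded ≤-refl 1≤n)

  wo≡1 : w o ≡ 1
  wo≡1 = w∘w⁻¹ ≤-refl 1≤n

  InY? : Decidable (λ v → o ≤ w⁻¹ v × v ≤ m)
  InY? v = (o ≤? w⁻¹ v) ×-dec (v ≤? m)

  ∈Y⁻ : ∀ {v} → v ∈ Y n w → (1 ≤ v × v ≤ n) × o ≤ w⁻¹ v × v ≤ m
  ∈Y⁻ v∈ with v∈range , o≤w⁻¹v , v≤m ← ∈-filter⁻ InY? {xs = range n} v∈ = ∈-range⁻ v∈range , o≤w⁻¹v , v≤m

  ∈Y⁺ : ∀ {v} → 1 ≤ v → v ≤ n → o ≤ w⁻¹ v → v ≤ m → v ∈ Y n w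
  ∈Y⁺ 1≤v v≤n o≤w⁻¹v v≤m = ∈-filter⁺ InY? (∈-range⁺ 1≤v v≤n) (o≤w⁻¹v , v≤m)

  y∘index : ∀ {v} (v∈ : v ∈ Y n w) → y n w (index v∈) ≡ v
  y∘index v∈ = sym (lookup-index v∈)

  y-strictMono : ∀ {a b} → a Fin.< b → y n w a < y n w b
  y-strictMono = AllPairs-lookup (AllPairs.filter⁺ InY? (range-sorted n))

  module y = StrictlyMonotone y-strictMono
  module w⁻¹∘y = StrictlyMonotone (λ {a} {b} → proj₁ wo a b)

  w⁻¹-strictMonoOnY : ∀ {u v} → u ∈ Y n w → v ∈ Y n w → u < v → w⁻¹ u < w⁻¹ v
  w⁻¹-strictMonoOnY u∈ v∈ u<v =
    subst₂ (λ u v → w⁻¹ u < w⁻¹ v) (y∘index u∈) (y∘index v∈)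
      (proj₁ wo _ _ (y.reflects-< (subst₂ _<_ (sym (y∘index u∈)) (sym (y∘index v∈)) u<v)))

  Straggler : ℕ → Set
  Straggler v = 1 ≤ v × w⁻¹ v < o

  straggler? : Decidable Straggler
  straggler? v = (1 ≤? v) ×-dec (w⁻¹ v <? o)

  straggler⇒1<v : ∀ {v} → Straggler v → 1 < v
  straggler⇒1<v {v} (1≤v , w⁻¹v<o) with m≤n⇒m<n∨m≡n 1≤v
  ... | inj₁ 1<v  = 1<v
  ... | inj₂ refl = ⊥-elim (<-irrefl refl w⁻¹v<o)

  NoStraggler : Set
  NoStraggler = ∀ v → v < m → ¬ Straggler v

  module _ (none : NoStraggler) where

    o≤w⁻¹ : ∀ {v} → 1 ≤ v → v ≤ m → o ≤ w⁻¹ v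
    o≤w⁻¹ 1≤v v≤m with m≤n⇒m<n∨m≡n v≤m
    ... | inj₁ v<m  = ≮⇒≥ λ w⁻¹v<o → none _ v<m (1≤v , w⁻¹v<o)
    ... | inj₂ refl = subst (o ≤_) (sym w⁻¹m≡n) o≤n

    ∈Y : ∀ {v} → 1 ≤ v → v ≤ m → v ∈ Y n w
    ∈Y 1≤v v≤m = ∈Y⁺ 1≤v (≤-trans v≤m m≤n) (o≤w⁻¹ 1≤v v≤m) v≤m

    w⁻¹-strictMono : ∀ {u v} → 1 ≤ u → u < v → v ≤ m → w⁻¹ u < w⁻¹ v
    w⁻¹-strictMono 1≤u u<v v≤m =
      w⁻¹-strictMonoOnY (∈Y 1≤u (<⇒≤ (<-≤-trans u<v v≤m))) (∈Y (≤-trans 1≤u (<⇒≤ u<v)) v≤m) u<v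

    w⁻¹-mono : ∀ {u v} → 1 ≤ u → u ≤ v → v ≤ m → w⁻¹ u ≤ w⁻¹ v
    w⁻¹-mono 1≤u u≤v v≤m with m≤n⇒m<n∨m≡n u≤v
    ... | inj₁ u<v  = <⇒≤ (w⁻¹-strictMono 1≤u u<v v≤m)
    ... | inj₂ refl = ≤-refl

    Y≡[1,m] : Y n w ≡ applyUpTo suc m
    Y≡[1,m] = begin
      filter InY? (range n)             ≡⟨ cong (filter InY?) (map-upTo suc n) ⟩
      filter InY? (applyUpTo suc n)     ≡⟨ filter-applyUpTo-suc InY? m n InY⇔≤m ⟩
      applyUpTo suc (m ⊓ n)             ≡⟨ cong (applyUpTo suc) (m≤n⇒m⊓n≡m m≤n) ⟩
      applyUpTo suc m                   ∎
      where
      open ≡-Reasoning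
      InY⇔≤m : ∀ {v} → 1 ≤ v → v ≤ n → (o ≤ w⁻¹ v × v ≤ m) ⇔ v ≤ m
      InY⇔≤m 1≤v _ = mk⇔ proj₂ λ v≤m → o≤w⁻¹ 1≤v v≤m , v≤m

    firstKind : FirstKind n w
    firstKind = wo , lookup-applyUpTo-suc m Y≡[1,m]

  last-straggler⇒2134 : ∀ {v} → v < m → Straggler v → (∀ u → v < u → u < m → ¬ Straggler u) →
                        h (w⁻¹ v) < n → Contains2134 n h w
  last-straggler⇒2134 {v} v<m sv@(1≤v , w⁻¹v<o) later h[v]<n =
    jump⇒2134 (crossing (λ u → w⁻¹ u ≤? h (w⁻¹ v)) v<m (generator 1≤v v<n) w⁻¹m≰h)
    where
    v<n = <-≤-trans v<m m≤n
    w⁻¹m≰h : ¬ w⁻¹ m ≤ h (w⁻¹ v)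
    w⁻¹m≰h le = <⇒≱ h[v]<n (subst (_≤ h (w⁻¹ v)) w⁻¹m≡n le)
    jump⇒2134 : (∃[ t ] v < t × t < m × w⁻¹ t ≤ h (w⁻¹ v) × ¬ w⁻¹ (suc t) ≤ h (w⁻¹ v)) →
                Contains2134 n h w
    jump⇒2134 (t , v<t , t<m , w⁻¹t≤h , w⁻¹t+1≰h) =
      w⁻¹ v , o , w⁻¹ t , w⁻¹ (suc t) ,
      proj₁ (w⁻¹-bounded 1≤v (<⇒≤ v<n)) , w⁻¹v<o , o<w⁻¹t , ≤-<-trans w⁻¹t≤h h<w⁻¹t+1 ,
      proj₂ (w⁻¹-bounded (s≤s z≤n) t<n) , generator 1≤t t<n , w⁻¹t≤h , h<w⁻¹t+1 ,
      w∘w⁻¹-< ≤-refl (straggler⇒1<v sv) (<⇒≤ v<n) , w∘w⁻¹-< 1≤v v<t t≤n , w∘w⁻¹-< 1≤t ≤-refl t<n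
      where
      t<n = <-≤-trans t<m m≤n
      t≤n = <⇒≤ t<n
      1≤t = ≤-trans 1≤v (<⇒≤ v<t)
      h<w⁻¹t+1 = ≰⇒> w⁻¹t+1≰h
      o<w⁻¹t : o < w⁻¹ t
      o<w⁻¹t = ≤∧≢⇒< (≮⇒≥ λ w⁻¹t<o → later t v<t t<m (1≤t , w⁻¹t<o))
        λ o≡w⁻¹t → <⇒≢ (≤-<-trans 1≤v v<t) (trans (sym wo≡1) (trans (cong w o≡w⁻¹t) (w∘w⁻¹ 1≤t t≤n)))

  h[o]<n⇒noStraggler : h o < n → ¬ Contains2134 n h w → NoStraggler
  h[o]<n⇒noStraggler h[o]<n no2134 v v<m sv with greatest-below straggler? m
  ... | inj₁ none = none v v<m sv
  ... | inj₂ (u , u<m , su@(1≤u , w⁻¹u<o) , later) =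
    no2134 (last-straggler⇒2134 u<m su later
      (≤-<-trans (h-mono (proj₁ (w⁻¹-bounded 1≤u (<⇒≤ (<-≤-trans u<m m≤n)))) (<⇒≤ w⁻¹u<o) o≤n) h[o]<n))

  ShortReach : ℕ → Set
  ShortReach u = 1 ≤ u × h (w⁻¹ u) < n

  shortReach? : Decidable ShortReach
  shortReach? u = (1 ≤? u) ×-dec (h (w⁻¹ u) <? n)

  module _ (none : NoStraggler) {x : ℕ} (x≤n : x ≤ n) (m<x : m < x) (h[x]≡n : h (w⁻¹ x) ≡ n) where

    straddle⇒1243 : ∀ {a d} → 1 ≤ d → d ≤ a → a < m → w⁻¹ a < w⁻¹ x → w⁻¹ x < w⁻¹ (suc a) →
                    (∀ u → d < u → u < suc a → ¬ ShortReach u) → h (w⁻¹ d) < w⁻¹ x → Contains1243 n h w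
    straddle⇒1243 {a} {d} 1≤d d≤a a<m w⁻¹a<w⁻¹x w⁻¹x<w⁻¹a+1 later h[d]<w⁻¹x =
      w⁻¹ d , w⁻¹ (suc d) , w⁻¹ x , w⁻¹ (suc a) ,
      proj₁ (w⁻¹-bounded 1≤d (<⇒≤ d<n)) , w⁻¹-strictMono none 1≤d ≤-refl d<m ,
      ≤-<-trans (w⁻¹-mono none (s≤s z≤n) d<a (<⇒≤ a<m)) w⁻¹a<w⁻¹x , w⁻¹x<w⁻¹a+1 ,
      w⁻¹a+1≤n , subst (w⁻¹ (suc a) ≤_) (sym h[d+1]≡n) w⁻¹a+1≤n ,
      generator 1≤d d<n , <-trans h[d]<w⁻¹x w⁻¹x<w⁻¹a+1 ,
      w∘w⁻¹-< 1≤d ≤-refl d<n , w∘w⁻¹-< (s≤s z≤n) (s≤s d<a) a<n ,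
      w∘w⁻¹-< (s≤s z≤n) (≤-<-trans a<m m<x) x≤n
      where
      a<n = <-≤-trans a<m m≤n
      w⁻¹a+1≤n = proj₂ (w⁻¹-bounded (s≤s z≤n) a<n)
      d<a : d < a
      d<a = ≤∧≢⇒< d≤a λ { refl → <-asym w⁻¹x<w⁻¹a+1 (≤-<-trans (generator 1≤d a<n) h[d]<w⁻¹x) }
      d<m = <-trans d<a a<m
      d<n = <-≤-trans d<m m≤n
      h[d+1]≡n : h (w⁻¹ (suc d)) ≡ n
      h[d+1]≡n = ≤-antisym (proj₂ (uncurry h-bounded (w⁻¹-bounded (s≤s z≤n) d<n)))
                           (≮⇒≥ λ h[d+1]<n → later (suc d) ≤-refl (s≤s d<a) (s≤s z≤n , h[d+1]<n))

    reach⇒1243⊎1423 : ∀ {d} → 1 ≤ d → d < m → h (w⁻¹ d) < n → w⁻¹ d < w⁻¹ x → w⁻¹ x ≤ h (w⁻¹ d) →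
                      Contains1243 n h w ⊎ Contains1423 n h w
    reach⇒1243⊎1423 {d} 1≤d d<m h[d]<n w⁻¹d<w⁻¹x w⁻¹x≤h =
      jump⇒1243⊎1423 (crossing (λ u → w⁻¹ u ≤? h (w⁻¹ d)) (<⇒≤ d<m) (proj₁ (uncurry h-bounded w⁻¹d-bounded)) w⁻¹m≰h)
      where
      d<n = <-≤-trans d<m m≤n
      w⁻¹d-bounded = w⁻¹-bounded 1≤d (<⇒≤ d<n)
      w⁻¹m≰h : ¬ w⁻¹ m ≤ h (w⁻¹ d)
      w⁻¹m≰h le = <⇒≱ h[d]<n (subst (_≤ h (w⁻¹ d)) w⁻¹m≡n le)
      jump⇒1243⊎1423 : (∃[ g ] d ≤ g × g < m × w⁻¹ g ≤ h (w⁻¹ d) × ¬ w⁻¹ (suc g) ≤ h (w⁻¹ d)) →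
                       Contains1243 n h w ⊎ Contains1423 n h w
      jump⇒1243⊎1423 (g , d≤g , g<m , w⁻¹g≤h , w⁻¹g+1≰h) = by-position (<-cmp (w⁻¹ g) (w⁻¹ x))
        where
        g<n = <-≤-trans g<m m≤n
        g≤n = <⇒≤ g<n
        g<x = <-trans g<m m<x
        g+1<x = ≤-<-trans g<m m<x
        h<w⁻¹g+1 = ≰⇒> w⁻¹g+1≰h
        w⁻¹g+1≤n = proj₂ (w⁻¹-bounded (s≤s z≤n) g<n)
        d<g : d < g
        d<g = ≤∧≢⇒< d≤g λ { refl → w⁻¹g+1≰h (generator 1≤d d<n) }
        1≤g = ≤-trans 1≤d (<⇒≤ d<g)
        by-position : Tri (w⁻¹ g < w⁻¹ x) (w⁻¹ g ≡ w⁻¹ x) (w⁻¹ x < w⁻¹ g) →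
                      Contains1243 n h w ⊎ Contains1423 n h w
        by-position (tri< w⁻¹g<w⁻¹x _ _) =
          inj₁ (w⁻¹ d , w⁻¹ g , w⁻¹ x , w⁻¹ (suc g) ,
                proj₁ w⁻¹d-bounded , w⁻¹-strictMono none 1≤d d<g (<⇒≤ g<m) , w⁻¹g<w⁻¹x ,
                ≤-<-trans w⁻¹x≤h h<w⁻¹g+1 , w⁻¹g+1≤n , generator 1≤g g<n , w⁻¹g≤h , h<w⁻¹g+1 ,
                w∘w⁻¹-< 1≤d d<g g≤n , w∘w⁻¹-< 1≤g ≤-refl g<n , w∘w⁻¹-< (s≤s z≤n) g+1<x x≤n)
        by-position (tri≈ _ w⁻¹g≡w⁻¹x _) =
          ⊥-elim (<⇒≢ g<x (w⁻¹-injective 1≤g g≤n (≤-trans (s≤s z≤n) g<x) x≤n w⁻¹g≡w⁻¹x))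
        by-position (tri> _ _ w⁻¹x<w⁻¹g) =
          inj₂ (w⁻¹ d , w⁻¹ x , w⁻¹ g , w⁻¹ (suc g) ,
                proj₁ w⁻¹d-bounded , w⁻¹d<w⁻¹x , w⁻¹x<w⁻¹g ,
                ≤-<-trans w⁻¹g≤h h<w⁻¹g+1 , w⁻¹g+1≤n , subst (w⁻¹ (suc g) ≤_) (sym h[x]≡n) w⁻¹g+1≤n ,
                w⁻¹g≤h , h<w⁻¹g+1 ,
                w∘w⁻¹-< 1≤d d<g g≤n , w∘w⁻¹-< 1≤g ≤-refl g<n , w∘w⁻¹-< (s≤s z≤n) g+1<x x≤n)

    beyond-m⇒⊥ : h o < n → ¬ Contains1243 n h w → ¬ Contains1423 n h w → ⊥
    beyond-m⇒⊥ h[o]<n no1243 no1423 = straddle (crossing (λ u → w⁻¹ u <? w⁻¹ x) 1≤m o<w⁻¹x w⁻¹m≮w⁻¹x)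
      where
      1≤x = ≤-trans 1≤m (<⇒≤ m<x)
      o<w⁻¹x : o < w⁻¹ x
      o<w⁻¹x = ≰⇒> λ w⁻¹x≤o →
        <⇒≱ h[o]<n (subst (_≤ h o) h[x]≡n (h-mono (proj₁ (w⁻¹-bounded 1≤x x≤n)) w⁻¹x≤o o≤n))
      w⁻¹m≮w⁻¹x : ¬ w⁻¹ m < w⁻¹ x
      w⁻¹m≮w⁻¹x lt = <⇒≱ (subst (_< w⁻¹ x) w⁻¹m≡n lt) (proj₂ (w⁻¹-bounded 1≤x x≤n))
      straddle : (∃[ a ] 1 ≤ a × a < m × w⁻¹ a < w⁻¹ x × ¬ w⁻¹ (suc a) < w⁻¹ x) → ⊥
      straddle (a , 1≤a , a<m , w⁻¹a<w⁻¹x , w⁻¹a+1≮w⁻¹x) with greatest-below shortReach? (suc a)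
      ... | inj₁ noShort = noShort 1 (s≤s 1≤a) (≤-refl , h[o]<n)
      ... | inj₂ (d , d<a+1 , (1≤d , h[d]<n) , later) with h (w⁻¹ d) <? w⁻¹ x
      ...   | yes h[d]<w⁻¹x = no1243 (straddle⇒1243 1≤d d≤a a<m w⁻¹a<w⁻¹x w⁻¹x<w⁻¹a+1 later h[d]<w⁻¹x)
        where
        d≤a = ≤-pred d<a+1
        w⁻¹x<w⁻¹a+1 : w⁻¹ x < w⁻¹ (suc a)
        w⁻¹x<w⁻¹a+1 = ≤∧≢⇒< (≮⇒≥ w⁻¹a+1≮w⁻¹x) λ w⁻¹x≡w⁻¹a+1 →
          <⇒≢ (≤-<-trans a<m m<x) (sym (w⁻¹-injective 1≤x x≤n (s≤s z≤n) (<-≤-trans a<m m≤n) w⁻¹x≡w⁻¹a+1))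
      ...   | no h[d]≮w⁻¹x =
        [ no1243 , no1423 ] (reach⇒1243⊎1423 1≤d (≤-<-trans d≤a a<m) h[d]<n
                               (≤-<-trans (w⁻¹-mono none 1≤d d≤a (<⇒≤ a<m)) w⁻¹a<w⁻¹x) (≮⇒≥ h[d]≮w⁻¹x))
        where
        d≤a = ≤-pred d<a+1

  full-reach⇒≤m : NoStraggler → h o < n → ¬ Contains1243 n h w → ¬ Contains1423 n h w →
                  ∀ {x} → x ≤ n → h (w⁻¹ x) ≡ n → x ≤ m
  full-reach⇒≤m none h[o]<n no1243 no1423 x≤n h[x]≡n =
    ≮⇒≥ λ m<x → beyond-m⇒⊥ none x≤n m<x h[x]≡n h[o]<n no1243 no1423

  full-reach⇒∈Y : NoStraggler → h o < n → ¬ Contains1243 n h w → ¬ Contains1423 n h w →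
                  ∀ i → 1 ≤ i → i ≤ n → h i ≡ n → w i ∈ Y n w
  full-reach⇒∈Y none h[o]<n no1243 no1423 i 1≤i i≤n h[i]≡n =
    ∈Y none 1≤wi (full-reach⇒≤m none h[o]<n no1243 no1423 wi≤n (subst (λ j → h j ≡ n) (sym (w⁻¹∘w 1≤i i≤n)) h[i]≡n))
    where
    1≤wi = proj₁ (w-bounded 1≤i i≤n)
    wi≤n = proj₂ (w-bounded 1≤i i≤n)

  TailBounded : Set
  TailBounded = ∀ q → o ≤ q → q ≤ n → w q ≤ m

  straggler⇒2143 : ∀ {v q} → Straggler v → v < m → n ≤ h (w⁻¹ v) → o ≤ q → q ≤ n → m < w q →
                   Contains2143 n h w
  straggler⇒2143 sv@(1≤v , w⁻¹v<o) v<m n≤h o≤q q≤n m<wq =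
    _ , _ , _ , n , proj₁ (w⁻¹-bounded 1≤v v≤n) , w⁻¹v<o , o<q , q<n , ≤-refl , n≤h ,
    w∘w⁻¹-< ≤-refl (straggler⇒1<v sv) v≤n , subst (_< m) (sym (w∘w⁻¹ 1≤v v≤n)) v<m , m<wq
    where
    v≤n = <⇒≤ (<-≤-trans v<m m≤n)
    o<q = ≤∧≢⇒< o≤q λ { refl → <⇒≱ m<wq (subst (_≤ m) (sym wo≡1) 1≤m) }
    q<n = ≤∧≢⇒< q≤n λ { refl → <-irrefl refl m<wq }

  noStraggler⊎tailBounded : ¬ Contains2143 n h w → ¬ Contains2134 n h w → NoStraggler ⊎ TailBounded
  noStraggler⊎tailBounded no2143 no2134 with greatest-below straggler? m
  ... | inj₁ none = inj₁ none
  ... | inj₂ (v , v<m , sv , later) with h (w⁻¹ v) <? n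
  ...   | yes h[v]<n = ⊥-elim (no2134 (last-straggler⇒2134 v<m sv later h[v]<n))
  ...   | no  h[v]≮n = inj₂ λ q o≤q q≤n → ≮⇒≥ (no2143 ∘ straggler⇒2143 sv v<m (≮⇒≥ h[v]≮n) o≤q q≤n)

  module _ (tail : TailBounded) where

    -- The position just left of y_{c+1} carries a value of Y, whose index is squeezed to c.
    w⁻¹∘y-step : ∀ {c c′ : Fin (length (Y n w))} {k} → toℕ c′ ≡ suc (toℕ c) →
                 w⁻¹ (y n w c′) ≡ k → w⁻¹ (y n w c) ≡ pred k
    w⁻¹∘y-step {c} {c′} {k} c′≡c+1 w⁻¹yc′≡k = trans (cong (w⁻¹ ∘ y n w) (sym e≡c)) w⁻¹ye≡q
      where
      q = pred k
      w⁻¹yc<k : w⁻¹ (y n w c) < k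
      w⁻¹yc<k = subst (w⁻¹ (y n w c) <_) w⁻¹yc′≡k (proj₁ wo c c′ (≤-reflexive (sym c′≡c+1)))
      w⁻¹yc≤q = proj₁ (pred-bounds w⁻¹yc<k)
      q<k = proj₂ (pred-bounds w⁻¹yc<k)
      o≤q = ≤-trans (proj₁ (proj₂ (∈Y⁻ (∈-lookup c)))) w⁻¹yc≤q
      1≤q = ≤-trans 1≤o o≤q
      q≤n : q ≤ n
      q≤n = ≤-trans (<⇒≤ q<k) (subst (_≤ n) w⁻¹yc′≡k (proj₂ (uncurry w⁻¹-bounded (proj₁ (∈Y⁻ (∈-lookup c′))))))
      wq∈Y : w q ∈ Y n w
      wq∈Y = ∈Y⁺ (proj₁ (w-bounded 1≤q q≤n)) (proj₂ (w-bounded 1≤q q≤n))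
                 (subst (o ≤_) (sym (w⁻¹∘w 1≤q q≤n)) o≤q) (tail q o≤q q≤n)
      e = index wq∈Y
      w⁻¹ye≡q : w⁻¹ (y n w e) ≡ q
      w⁻¹ye≡q = trans (cong w⁻¹ (y∘index wq∈Y)) (w⁻¹∘w 1≤q q≤n)
      e≡c : e ≡ c
      e≡c = Fin.toℕ-injective (≤-antisym
        (≤-pred (subst (toℕ e <_) c′≡c+1 (w⁻¹∘y.reflects-< (subst₂ _<_ (sym w⁻¹ye≡q) (sym w⁻¹yc′≡k) q<k))))
        (w⁻¹∘y.reflects-≤ (subst (w⁻¹ (y n w c) ≤_) (sym w⁻¹ye≡q) w⁻¹yc≤q)))

    w⁻¹∘y≡n∸ : ∀ t (c : Fin (length (Y n w))) → suc (toℕ c + t) ≡ length (Y n w) → w⁻¹ (y n w c) ≡ n ∸ t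
    w⁻¹∘y≡n∸ zero    c c+1≡r+1   = proj₂ wo c (trans (cong suc (sym (+-identityʳ (toℕ c)))) c+1≡r+1)
    w⁻¹∘y≡n∸ (suc t) c c+t+2≡r+1 =
      trans (w⁻¹∘y-step (Fin.toℕ-fromℕ< c+1<r+1) (w⁻¹∘y≡n∸ t (fromℕ< c+1<r+1) c′+t+1≡r+1)) (pred[m∸n]≡m∸[1+n] n t)
      where
      c+1<r+1 : suc (toℕ c) < length (Y n w)
      c+1<r+1 = subst (suc (suc (toℕ c)) ≤_) c+t+2≡r+1 (s≤s (m<m+n (toℕ c) z<s))
      c′+t+1≡r+1 : suc (toℕ (fromℕ< c+1<r+1) + t) ≡ length (Y n w)
      c′+t+1≡r+1 = trans (cong (λ j → suc (j + t)) (Fin.toℕ-fromℕ< c+1<r+1))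
                         (trans (cong suc (sym (+-suc (toℕ c) t))) c+t+2≡r+1)

    secondKind : SecondKind n w
    secondKind = wo , λ i → begin
      w (n ∸ toℕ i)                 ≡⟨ cong w (w⁻¹∘y≡n∸ (toℕ i) (opposite i) (opposite+i+1≡r+1 i)) ⟨
      w (w⁻¹ (y n w (opposite i)))  ≡⟨ uncurry w∘w⁻¹ (proj₁ (∈Y⁻ (∈-lookup (opposite i)))) ⟩
      y n w (opposite i)            ∎
      where
      open ≡-Reasoning
      opposite+i+1≡r+1 : ∀ i → suc (toℕ (opposite i) + toℕ i) ≡ length (Y n w)
      opposite+i+1≡r+1 i = begin
        suc (toℕ (opposite i) + toℕ i)             ≡⟨ cong (λ j → suc (j + toℕ i)) (Fin.opposite-prop i) ⟩
        suc (length (Y n w) ∸ suc (toℕ i) + toℕ i) ≡⟨ +-suc _ (toℕ i) ⟨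
        length (Y n w) ∸ suc (toℕ i) + suc (toℕ i) ≡⟨ m∸n+n≡m (Fin.toℕ<n i) ⟩
        length (Y n w)                             ∎

lemma4p5 : (n : ℕ) (h w : ℕ → ℕ) →
    IsHessenberg n h → IsPerm n w → IsGenerator n h w → IsWellOrganized n w →
    ((h (inv n w 1) < n → ¬ Contains2134 n h w →
        FirstKind n w ×
        (¬ Contains1243 n h w → ¬ Contains1423 n h w →
           ∀ i → 1 ≤ i → i ≤ n → h i ≡ n → w i ∈ Y n w))
    ×
     (h (inv n w 1) ≡ n → ¬ Contains2143 n h w → ¬ Contains2134 n h w →
        FirstKind n w ⊎ SecondKind n w))
-- Part (2) does not need h(w⁻¹ 1) = n.
lemma4p5 zero    h w _    _    _   wo = (λ ()) , λ _ _ _ → inj₁ (wo , λ ())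
lemma4p5 (suc _) h w hess perm gen wo =
  (λ h[o]<n no2134 → let none = h[o]<n⇒noStraggler h[o]<n no2134 in firstKind none , full-reach⇒∈Y none h[o]<n) ,
  (λ _ no2143 no2134 → Sum.map firstKind secondKind (noStraggler⊎tailBounded no2143 no2134))
  where open Setting hess perm gen wo (s≤s z≤n)
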